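{- Let $G$ be a finite connected simple graph on $[d]$ and suppose $\mathcal{P}_G\subset\mathbb{R}^d$ is decomposable by a separating hyperplane $\mathcal{H}$. Then each of $\mathcal{P}_G\cap\mathcal{H}^{(+)}$ and $\mathcal{P}_G\cap\mathcal{H}^{(-)}$ is again an edge polytope; more precisely, there are connected spanning subgraphs $G_+$ and $G_-$ of $G$ with $\mathcal{P}_G\cap\mathcal{H}^{(+)}=\mathcal{P}_{G_+}$ and $\mathcal{P}_G\cap\mathcal{H}^{(-)}=\mathcal{P}_{G_- }$.
   Context: For an edge $e=(i,j)$ of a graph on $[d]$, $\rho(e)=\mathbf{e}_i+\mathbf{e}_j\in\mathbb{R}^d$; the edge polytope of a graph $H$ is the convex hull of $\{\rho(e):e\in E(H)\}$. A separating hyperplane of a polytope $P$ is a hyperplane $\mathcal{H}$ meeting the relative interior of $P$ (and not containing $P$) such that $P\cap\mathcal{H}^{(+)}$ and $P\cap\mathcal{H}^{(-)}$ are integral polytopes, where $\mathcal{H}^{(+)},\mathcal{H}^{(-)}$ are the two closed half-spaces with intersection $\mathcal{H}$; $P$ is decomposable if it has a separating hyperplane. A spanning subgraph of $G$ has vertex set $[d]$ and edge set contained in $E(G)$.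
   Formalization: The separating hyperplane $\mathcal{H}$ has rational coefficients, and all polytopes and half-spaces are taken in ℚ^d rather than $\mathbb{R}^d$. -}

module Defs where

open import Data.Nat using (ℕ; zero; suc)
open import Data.Fin using (Fin; zero; suc)
open import Data.Bool using (Bool; true; false)
open import Data.Integer using (ℤ)
open import Data.Rational using (ℚ; 0ℚ; 1ℚ; _+_; _*_; _-_; _≤_; _<_; _/_)
open import Data.Product using (Σ; _×_; ∃; ∃-syntax)
open import Relation.Binary.PropositionalEquality using (_≡_)
open import Relation.Nullary using (¬_)
open import Function.Bundles using (_⇔_)

Σ[_] : (n : ℕ) → (Fin n → ℚ) → ℚ
Σ[ zero ] f = 0ℚ
Σ[ suc n ] f = f zero + Σ[ n ] (λ i → f (suc i))

-- points of ℚ^d (rational points of ℝ^d)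
Point : ℕ → Set
Point d = Fin d → ℚ

Region : ℕ → Set₁
Region d = Point d → Set

_≐_ : ∀ {d} → Region d → Region d → Set
P ≐ Q = ∀ x → P x ⇔ Q x

δ : ∀ {d} → Fin d → Fin d → ℚ
δ zero zero = 1ℚ
δ zero (suc j) = 0ℚ
δ (suc i) zero = 0ℚ
δ (suc i) (suc j) = δ i j

ρ : ∀ {d} → Fin d → Fin d → Point d
ρ i j k = δ i k + δ j k

Conv : ∀ {d m} → (Fin m → Point d) → Region d
Conv {d} {m} v x = Σ (Fin m → ℚ) λ λ' →
  (∀ t → 0ℚ ≤ λ' t) × (Σ[ m ] λ' ≡ 1ℚ) × (∀ k → x k ≡ Σ[ m ] (λ t → λ' t * v t k))

IntegralPolytope : ∀ {d} → Region d → Set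
IntegralPolytope {d} P = ∃[ m ] Σ (Fin m → Fin d → ℤ) λ v →
  P ≐ Conv (λ t k → v t k / 1)

record Graph (d : ℕ) : Set where
  field
    adj    : Fin d → Fin d → Bool
    sym    : ∀ i j → adj i j ≡ adj j i
    irrefl : ∀ i → adj i i ≡ false
open Graph public

data Reach {d} (G : Graph d) : Fin d → Fin d → Set where
  here : ∀ {i} → Reach G i i
  step : ∀ {i j k} → adj G i j ≡ true → Reach G j k → Reach G i k

Connected : ∀ {d} → Graph d → Set
Connected {d} G = ∀ (i j : Fin d) → Reach G i j

SpanningSubgraph : ∀ {d} → Graph d → Graph d → Set
SpanningSubgraph H G = ∀ i j → adj H i j ≡ true → adj G i j ≡ true

-- edge polytope: convex hull of {ρ(e) : e ∈ E(G)}; weights indexed by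
-- ordered pairs (i,j), forced to vanish on non-edges
EdgePolytope : ∀ {d} → Graph d → Region d
EdgePolytope {d} G x = Σ (Fin d → Fin d → ℚ) λ λ' →
  (∀ i j → 0ℚ ≤ λ' i j) × (∀ i j → adj G i j ≡ false → λ' i j ≡ 0ℚ) ×
  (Σ[ d ] (λ i → Σ[ d ] (λ j → λ' i j)) ≡ 1ℚ) ×
  (∀ k → x k ≡ Σ[ d ] (λ i → Σ[ d ] (λ j → λ' i j * ρ i j k)))

record Hyperplane (d : ℕ) : Set where
  field
    a       : Point d
    b       : ℚ
    nonzero : ¬ (∀ k → a k ≡ 0ℚ)
open Hyperplane public

dot : ∀ {d} → Point d → Point d → ℚ
dot {d} a x = Σ[ d ] (λ k → a k * x k)

OnH : ∀ {d} → Hyperplane d → Region d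
OnH H x = dot (a H) x ≡ b H

H⁺ : ∀ {d} → Hyperplane d → Region d
H⁺ H x = b H ≤ dot (a H) x

H⁻ : ∀ {d} → Hyperplane d → Region d
H⁻ H x = dot (a H) x ≤ b H

_∩_ : ∀ {d} → Region d → Region d → Region d
(P ∩ Q) x = P x × Q x

-- relative interior of a convex set P: x ∈ P and for every y ∈ P the segment
-- from y through x extends beyond x inside P (Rockafellar, Thm 6.4)
RelInt : ∀ {d} → Region d → Region d
RelInt {d} P x = P x × (∀ y → P y → ∃[ ε ] (0ℚ < ε × P (λ k → x k + ε * (x k - y k))))

Separating : ∀ {d} → Region d → Hyperplane d → Set
Separating P H =
  (∃[ x ] (RelInt P x × OnH H x)) ×
  (∃[ y ] (P y × ¬ OnH H y)) ×
  IntegralPolytope (P ∩ H⁺ H) × IntegralPolytope (P ∩ H⁻ H)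

Decomposable : ∀ {d} → Region d → Set
Decomposable {d} P = ∃[ H ] Separating {d} P H

-- Write H = {x | a·x = b} and let G₊ keep the edges ij of G with a_i + a_j ≥ b, i.e. those whose
-- vertex ρ(ij) lies in H⁺. Clearly P_{G₊} ⊆ P_G ∩ H⁺. Conversely, every vertex of the integral polytope
-- P_G ∩ H⁺ is a lattice point of P_G; as coordinates of P_G are nonnegative and sum to 2, the only
-- lattice points of P_G are the ρ(e), so P_G ∩ H⁺ = P_{G₊}.
-- For connectivity, let S be a union of components of G₊ and uw an edge of G with u ∉ S, w ∈ S, so
-- that a_u + a_w < b. Since H meets the relative interior of P_G, a linear functional c with
-- c_i + c_j = 0 on all edges of G₊ (hence vanishing on P_G ∩ H⁺) also vanishes at ρ(uw). Every G₊-edge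
-- inside S lies on H, so c = 𝟙_S · (2a − b) is such a functional and 2a_w = b; the complement of S
-- gives 2a_u = b, contradicting a_u + a_w < b. The side H⁻ is the side H⁺ of (−a, −b).

{-# OPTIONS --safe #-}
module Submission where

open import Defs renaming (sym to adj-sym)
open import Algebra.Bundles using (CommutativeRing)
open import Data.Bool using (true; false; _∧_; if_then_else_)
import Data.Bool.Properties as Bool
open import Data.Empty using (⊥-elim)
open import Data.Fin using (Fin; zero; suc)
open import Data.Fin.Properties using (any?) renaming (_≟_ to _≟ᶠ_)
open import Data.Fin.Subset using (Subset; _∈_; _∉_; _⊂_; ⁅_⁆; _∪_; ∁; ∣_∣)
open import Data.Fin.Subset.Properties
  using (_∈?_; x∈⁅x⁆; x∈⁅y⁆⇒x≡y; p⊆p∪q; q⊆p∪q; x∈p∪q⁻; p⊂q⇒∣p∣<∣q∣; ∣p∣≤n; x∈∁p⇒x∉p; x∉p⇒x∈∁p; x∈p⇒x∉∁p)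
open import Data.Integer using (ℤ)
import Data.Integer as ℤ
import Data.Integer.Properties as ℤ
open import Data.Nat using (ℕ; zero; suc)
import Data.Nat as ℕ
import Data.Nat.Properties as ℕ
open import Data.Product using (Σ; _×_; _,_; proj₁; proj₂; map₂; ∃₂; ∃-syntax)
open import Data.Rational
  using (ℚ; 0ℚ; 1ℚ; _+_; _*_; _-_; -_; _/_; _≤_; _<_; 1/_; NonZero; ≢-nonZero; positive; nonNegative)
open import Data.Rational.Properties
import Data.Rational.Unnormalised as ℚᵘ
import Data.Rational.Unnormalised.Properties as ℚᵘ
open import Data.Rational.Solver using (module +-*-Solver)
open import Data.Sum using (_⊎_; inj₁; inj₂; [_,_]′)
open import Function.Base using (id)
open import Function.Bundles using (_⇔_; mk⇔; Equivalence)
import Function.Properties.Equivalence as ⇔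
open import Relation.Binary.PropositionalEquality
open import Relation.Nullary using (¬_; ¬?; Dec; yes; no; does; contradiction; _×-dec_)
open import Relation.Nullary.Decidable using (decidable-stable; dec-true; dec-false)

open import Algebra.Properties.Semiring.Sum (CommutativeRing.semiring +-*-commutativeRing)
  using (sum; ∑-distrib-+; ∑-comm; *-distribˡ-sum; sum-replicate-zero)
open import Algebra.Properties.Group +-0-group using ()
  renaming (∙-cancelˡ to +-cancelˡ; ⁻¹-involutive to neg-involutive; x∙y⁻¹≈ε⇒x≈y to p-q≡0⇒p≡q)
open +-*-Solver using (solve; con; _:+_; _:*_; :-_; _:-_; _:=_)

private
  variable
    d m : ℕ
    p q : ℚ

nonNeg*nonNeg : 0ℚ ≤ p → 0ℚ ≤ q → 0ℚ ≤ p * q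
nonNeg*nonNeg {p} {q} p≥0 q≥0 =
  nonNegative⁻¹ _ {{nonNeg*nonNeg⇒nonNeg p {{nonNegative p≥0}} q {{nonNegative q≥0}}}}

p≤p+q : 0ℚ ≤ q → p ≤ p + q
p≤p+q {q} {p} q≥0 = ≤-trans (≤-reflexive (sym (+-identityʳ p))) (+-monoʳ-≤ p q≥0)

p≤q+p : 0ℚ ≤ q → p ≤ q + p
p≤q+p {q} {p} q≥0 = ≤-trans (≤-reflexive (sym (+-identityˡ p))) (+-monoˡ-≤ p q≥0)

p≤q⇒0≤q-p : p ≤ q → 0ℚ ≤ q - p
p≤q⇒0≤q-p {p} {q} p≤q = subst (_≤ q - p) (+-inverseʳ p) (+-monoˡ-≤ (- p) p≤q)

p<q⇒0<q-p : p < q → 0ℚ < q - p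
p<q⇒0<q-p {p} {q} p<q = subst (_< q - p) (+-inverseʳ p) (+-monoˡ-< (- p) p<q)

nonneg∧≢0⇒pos : 0ℚ ≤ p → ¬ p ≡ 0ℚ → 0ℚ < p
nonneg∧≢0⇒pos {p} p≥0 p≢0 = positive⁻¹ p {{nonNeg∧nonZero⇒pos p {{nonNegative p≥0}} {{≢-nonZero p≢0}}}}

*-cancelˡ-≡0 : 0ℚ < p → p * q ≡ 0ℚ → q ≡ 0ℚ
*-cancelˡ-≡0 {p} {q} p>0 pq≡0 = ≤-antisym (cancel pq≡p0) (cancel (sym pq≡p0))
  where
  pq≡p0 : p * q ≡ p * 0ℚ
  pq≡p0 = trans pq≡0 (sym (*-zeroʳ p))
  cancel : ∀ {x y} → p * x ≡ p * y → x ≤ y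
  cancel e = *-cancelˡ-≤-pos p {{positive p>0}} (≤-reflexive e)

positive-integer⇒≥1 : (z : ℤ) → 0ℚ < z / 1 → 1ℚ ≤ z / 1
positive-integer⇒≥1 z z>0 =
  toℚᵘ-cancel-≤ (ℚᵘ.≤-respʳ-≃ (ℚᵘ.≃-sym (toℚᵘ-fromℚᵘ zᵘ)) (ℚᵘ.*≤* (ℤ.i<j⇒suc[i]≤j 0<z)))
  where
  zᵘ : ℚᵘ.ℚᵘ
  zᵘ = ℚᵘ.mkℚᵘ z 0
  0<z : ℤ.+ 0 ℤ.* ℤ.+ 1 ℤ.< z ℤ.* ℤ.+ 1
  0<z with ℚᵘ.<-respʳ-≃ (toℚᵘ-fromℚᵘ zᵘ) (toℚᵘ-mono-< z>0)
  ... | ℚᵘ.*<* 0<z = 0<z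

-- Solving t A + s B = b with t + s = 1 gives t = (b - B)/(A - B) and s = (A - b)/(A - B).
convex-weights : ∀ {A B b} → B ≤ b → b < A →
  ∃₂ λ t s → 0ℚ ≤ t × 0ℚ < s × t + s ≡ 1ℚ × t * A + s * B ≡ b
convex-weights {A} {B} {b} B≤b b<A =
  t , s , nonNeg*nonNeg (p≤q⇒0≤q-p B≤b) (<⇒≤ ι>0) , s>0 , t+s≡1 , tA+sB≡b
  where
  A-B>0 : 0ℚ < A - B
  A-B>0 = p<q⇒0<q-p (≤-<-trans B≤b b<A)
  instance
    A-B≢0 : NonZero (A - B)
    A-B≢0 = pos⇒nonZero (A - B) {{positive A-B>0}}
  ι : ℚ
  ι = 1/ (A - B)
  ι>0 : 0ℚ < ι
  ι>0 = positive⁻¹ ι {{1/pos⇒pos (A - B) {{positive A-B>0}}}}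
  t s : ℚ
  t = (b - B) * ι
  s = (A - b) * ι
  s>0 : 0ℚ < s
  s>0 = subst (_< s) (*-zeroˡ ι) (*-monoˡ-<-pos ι {{positive ι>0}} (p<q⇒0<q-p b<A))
  t+s≡1 : t + s ≡ 1ℚ
  t+s≡1 = trans (solve 4 (λ b B A i → (b :- B) :* i :+ (A :- b) :* i := (A :- B) :* i) refl b B A ι)
                (*-inverseʳ (A - B))
  tA+sB≡b : t * A + s * B ≡ b
  tA+sB≡b = begin
    t * A + s * B           ≡⟨ solve 4 (λ b B A i → (b :- B) :* i :* A :+ (A :- b) :* i :* B := b :* ((A :- B) :* i)) refl b B A ι ⟩
    b * ((A - B) * ι)       ≡⟨ cong (b *_) (*-inverseʳ (A - B)) ⟩
    b * 1ℚ                  ≡⟨ *-identityʳ b ⟩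
    b                       ∎
    where open ≡-Reasoning

Σ≡sum : ∀ n (f : Fin n → ℚ) → Σ[ n ] f ≡ sum f
Σ≡sum zero    f = refl
Σ≡sum (suc n) f = cong (f zero +_) (Σ≡sum n (λ i → f (suc i)))

Σ-cong : ∀ n {f g : Fin n → ℚ} → (∀ i → f i ≡ g i) → Σ[ n ] f ≡ Σ[ n ] g
Σ-cong zero    f≗g = refl
Σ-cong (suc n) f≗g = cong₂ _+_ (f≗g zero) (Σ-cong n (λ i → f≗g (suc i)))

Σ-zero : ∀ n → Σ[ n ] (λ _ → 0ℚ) ≡ 0ℚ
Σ-zero n = trans (Σ≡sum n _) (sum-replicate-zero n)

Σ-+ : ∀ n (f g : Fin n → ℚ) → Σ[ n ] (λ i → f i + g i) ≡ Σ[ n ] f + Σ[ n ] g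
Σ-+ n f g = trans (Σ≡sum n _) (trans (∑-distrib-+ f g) (sym (cong₂ _+_ (Σ≡sum n f) (Σ≡sum n g))))

Σ-*ˡ : ∀ n c (f : Fin n → ℚ) → Σ[ n ] (λ i → c * f i) ≡ c * Σ[ n ] f
Σ-*ˡ n c f = trans (Σ≡sum n _) (sym (trans (cong (c *_) (Σ≡sum n f)) (*-distribˡ-sum c f)))

Σ-*ʳ : ∀ n c (f : Fin n → ℚ) → Σ[ n ] (λ i → f i * c) ≡ Σ[ n ] f * c
Σ-*ʳ n c f = trans (Σ-cong n (λ i → *-comm (f i) c)) (trans (Σ-*ˡ n c f) (*-comm c _))

Σ-comm : ∀ m n (f : Fin m → Fin n → ℚ) →
  Σ[ m ] (λ i → Σ[ n ] (f i)) ≡ Σ[ n ] (λ j → Σ[ m ] (λ i → f i j))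
Σ-comm m n f = begin
  Σ[ m ] (λ i → Σ[ n ] (f i))            ≡⟨ Σ-cong m (λ i → Σ≡sum n (f i)) ⟩
  Σ[ m ] (λ i → sum (f i))               ≡⟨ Σ≡sum m _ ⟩
  sum (λ i → sum (f i))                  ≡⟨ ∑-comm f ⟩
  sum (λ j → sum (λ i → f i j))          ≡⟨ Σ≡sum n _ ⟨
  Σ[ n ] (λ j → sum (λ i → f i j))       ≡⟨ Σ-cong n (λ j → Σ≡sum m (λ i → f i j)) ⟨
  Σ[ n ] (λ j → Σ[ m ] (λ i → f i j))    ∎
  where open ≡-Reasoning

Σ-mono : ∀ n {f g : Fin n → ℚ} → (∀ i → f i ≤ g i) → Σ[ n ] f ≤ Σ[ n ] g
Σ-mono zero    f≤g = ≤-refl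
Σ-mono (suc n) f≤g = +-mono-≤ (f≤g zero) (Σ-mono n (λ i → f≤g (suc i)))

Σ-nonneg : ∀ n {f : Fin n → ℚ} → (∀ i → 0ℚ ≤ f i) → 0ℚ ≤ Σ[ n ] f
Σ-nonneg n f≥0 = ≤-trans (≤-reflexive (sym (Σ-zero n))) (Σ-mono n f≥0)

term≤Σ : ∀ n {f : Fin n → ℚ} → (∀ i → 0ℚ ≤ f i) → ∀ i → f i ≤ Σ[ n ] f
term≤Σ (suc n) f≥0 zero    = p≤p+q (Σ-nonneg n (λ i → f≥0 (suc i)))
term≤Σ (suc n) f≥0 (suc i) = ≤-trans (term≤Σ n (λ i → f≥0 (suc i)) i) (p≤q+p (f≥0 zero))

Σ-≤-≡ : ∀ n {f g : Fin n → ℚ} → (∀ i → f i ≤ g i) → Σ[ n ] f ≡ Σ[ n ] g → ∀ i → f i ≡ g i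
Σ-≤-≡ (suc n) {f} {g} f≤g Σf≡Σg = λ
  { zero    → head≡
  ; (suc i) → Σ-≤-≡ n (λ i → f≤g (suc i)) (+-cancelˡ (f zero) _ _ (trans Σf≡Σg (cong (_+ _) (sym head≡)))) i }
  where
  head≡ : f zero ≡ g zero
  head≡ with f zero <? g zero
  ... | yes f₀<g₀ = ⊥-elim (<-irrefl Σf≡Σg (+-mono-<-≤ f₀<g₀ (Σ-mono n (λ i → f≤g (suc i)))))
  ... | no  f₀≮g₀ = ≤-antisym (f≤g zero) (≮⇒≥ f₀≮g₀)

Σ-pos : ∀ n {f : Fin n → ℚ} → 0ℚ < Σ[ n ] f → ∃[ i ] (0ℚ < f i)
Σ-pos n {f} Σf>0 with any? (λ i → 0ℚ <? f i)
... | yes found = found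
... | no  none  = ⊥-elim (<-irrefl refl (<-≤-trans Σf>0 (≤-trans (Σ-mono n f≤0) (≤-reflexive (Σ-zero n)))))
  where
  f≤0 : ∀ i → f i ≤ 0ℚ
  f≤0 i = ≮⇒≥ (λ f>0 → none (i , f>0))

δ-diag : (i : Fin d) → δ i i ≡ 1ℚ
δ-diag zero    = refl
δ-diag (suc i) = δ-diag i

δ-off : (i k : Fin d) → ¬ i ≡ k → δ i k ≡ 0ℚ
δ-off zero    zero    i≢k = ⊥-elim (i≢k refl)
δ-off zero    (suc k) i≢k = refl
δ-off (suc i) zero    i≢k = refl
δ-off (suc i) (suc k) i≢k = δ-off i k (λ i≡k → i≢k (cong suc i≡k))

δ-nonneg : (i k : Fin d) → 0ℚ ≤ δ i k
δ-nonneg zero    zero    = <⇒≤ (positive⁻¹ 1ℚ)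
δ-nonneg zero    (suc k) = ≤-refl
δ-nonneg (suc i) zero    = ≤-refl
δ-nonneg (suc i) (suc k) = δ-nonneg i k

Σ-δ : ∀ n (i : Fin n) (g : Fin n → ℚ) → Σ[ n ] (λ k → δ i k * g k) ≡ g i
Σ-δ (suc n) zero    g = begin
  1ℚ * g zero + Σ[ n ] (λ k → 0ℚ * g (suc k))  ≡⟨ cong₂ _+_ (*-identityˡ (g zero)) (Σ-cong n (λ k → *-zeroˡ (g (suc k)))) ⟩
  g zero + Σ[ n ] (λ _ → 0ℚ)                   ≡⟨ cong (g zero +_) (Σ-zero n) ⟩
  g zero + 0ℚ                                  ≡⟨ +-identityʳ (g zero) ⟩
  g zero                                       ∎
  where open ≡-Reasoning
Σ-δ (suc n) (suc i) g =
  trans (cong₂ _+_ (*-zeroˡ (g zero)) (Σ-δ n i (λ k → g (suc k)))) (+-identityˡ (g (suc i)))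

ρ-nonneg : (i j k : Fin d) → 0ℚ ≤ ρ i j k
ρ-nonneg i j k = +-mono-≤ (δ-nonneg i k) (δ-nonneg j k)

ρ-outside : (i j k : Fin d) → ¬ k ≡ i → ¬ k ≡ j → ρ i j k ≡ 0ℚ
ρ-outside i j k k≢i k≢j =
  cong₂ _+_ (δ-off i k (λ i≡k → k≢i (sym i≡k))) (δ-off j k (λ j≡k → k≢j (sym j≡k)))

ρ-support : (i j k : Fin d) → 0ℚ < ρ i j k → k ≡ i ⊎ k ≡ j
ρ-support i j k ρ>0 with k ≟ᶠ i | k ≟ᶠ j
... | yes k≡i | _       = inj₁ k≡i
... | no  _   | yes k≡j = inj₂ k≡j
... | no  k≢i | no  k≢j = ⊥-elim (<-irrefl (sym (ρ-outside i j k k≢i k≢j)) ρ>0)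

segment-support : (t s : ℚ) (p q u w k : Fin d) → 0ℚ < t * ρ p q k + s * ρ u w k →
  (k ≡ p ⊎ k ≡ q) ⊎ (k ≡ u ⊎ k ≡ w)
segment-support t s p q u w k c>0 with k ≟ᶠ p | k ≟ᶠ q | k ≟ᶠ u | k ≟ᶠ w
... | yes k≡p | _       | _       | _       = inj₁ (inj₁ k≡p)
... | no  _   | yes k≡q | _       | _       = inj₁ (inj₂ k≡q)
... | no  _   | no  _   | yes k≡u | _       = inj₂ (inj₁ k≡u)
... | no  _   | no  _   | no  _   | yes k≡w = inj₂ (inj₂ k≡w)
... | no  k≢p | no  k≢q | no  k≢u | no  k≢w = ⊥-elim (<-irrefl (sym c≡0) c>0)
  where
  c≡0 : t * ρ p q k + s * ρ u w k ≡ 0ℚ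
  c≡0 = trans (cong₂ (λ X Y → t * X + s * Y) (ρ-outside p q k k≢p k≢q) (ρ-outside u w k k≢u k≢w))
              (solve 2 (λ t s → t :* con 0ℚ :+ s :* con 0ℚ := con 0ℚ) refl t s)

ρ-endpoint : (i j k : Fin d) → ¬ i ≡ j → k ≡ i ⊎ k ≡ j → ρ i j k ≡ 1ℚ
ρ-endpoint i j .i i≢j (inj₁ refl) = trans (cong₂ _+_ (δ-diag i) (δ-off j i (λ j≡i → i≢j (sym j≡i)))) (+-identityʳ 1ℚ)
ρ-endpoint i j .j i≢j (inj₂ refl) = trans (cong₂ _+_ (δ-off i j i≢j) (δ-diag j)) (+-identityˡ 1ℚ)

ρ-endpoint≥1 : (i j k : Fin d) → k ≡ i ⊎ k ≡ j → 1ℚ ≤ ρ i j k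
ρ-endpoint≥1 i j .i (inj₁ refl) = subst (λ δᵢᵢ → 1ℚ ≤ δᵢᵢ + δ j i) (sym (δ-diag i)) (p≤p+q (δ-nonneg j i))
ρ-endpoint≥1 i j .j (inj₂ refl) = subst (λ δⱼⱼ → 1ℚ ≤ δ i j + δⱼⱼ) (sym (δ-diag j)) (p≤q+p (δ-nonneg i j))

dot-cong : (c : Point d) {x y : Point d} → (∀ k → x k ≡ y k) → dot c x ≡ dot c y
dot-cong {d} c x≗y = Σ-cong d (λ k → cong (c k *_) (x≗y k))

dot-ρ : (c : Point d) (i j : Fin d) → dot c (ρ i j) ≡ c i + c j
dot-ρ {d} c i j = begin
  Σ[ d ] (λ k → c k * (δ i k + δ j k))            ≡⟨ Σ-cong d (λ k → solve 3 (λ c x y → c :* (x :+ y) := x :* c :+ y :* c) refl (c k) (δ i k) (δ j k)) ⟩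
  Σ[ d ] (λ k → δ i k * c k + δ j k * c k)        ≡⟨ Σ-+ d _ _ ⟩
  Σ[ d ] (λ k → δ i k * c k) + Σ[ d ] (λ k → δ j k * c k) ≡⟨ cong₂ _+_ (Σ-δ d i c) (Σ-δ d j c) ⟩
  c i + c j                                       ∎
  where open ≡-Reasoning

dot-affine : (c x y : Point d) (p q : ℚ) → dot c (λ k → p * x k + q * y k) ≡ p * dot c x + q * dot c y
dot-affine {d} c x y p q = begin
  Σ[ d ] (λ k → c k * (p * x k + q * y k))               ≡⟨ Σ-cong d (λ k → solve 5 (λ c x y p q → c :* (p :* x :+ q :* y) := p :* (c :* x) :+ q :* (c :* y)) refl (c k) (x k) (y k) p q) ⟩
  Σ[ d ] (λ k → p * (c k * x k) + q * (c k * y k))       ≡⟨ Σ-+ d _ _ ⟩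
  Σ[ d ] (λ k → p * (c k * x k)) + Σ[ d ] (λ k → q * (c k * y k)) ≡⟨ cong₂ _+_ (Σ-*ˡ d p _) (Σ-*ˡ d q _) ⟩
  p * dot c x + q * dot c y                              ∎
  where open ≡-Reasoning

dot-neg : (c x : Point d) → dot (λ k → - c k) x ≡ - dot c x
dot-neg {d} c x = begin
  Σ[ d ] (λ k → - c k * x k)       ≡⟨ Σ-cong d (λ k → solve 2 (λ c x → :- c :* x := (:- con 1ℚ) :* (c :* x)) refl (c k) (x k)) ⟩
  Σ[ d ] (λ k → - 1ℚ * (c k * x k)) ≡⟨ Σ-*ˡ d (- 1ℚ) _ ⟩
  - 1ℚ * dot c x                   ≡⟨ solve 1 (λ D → (:- con 1ℚ) :* D := :- D) refl (dot c x) ⟩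
  - dot c x                        ∎
  where open ≡-Reasoning

dot-extension : (c x y : Point d) (ε : ℚ) →
  dot c (λ k → x k + ε * (x k - y k)) ≡ dot c x + ε * (dot c x - dot c y)
dot-extension c x y ε = begin
  dot c (λ k → x k + ε * (x k - y k))           ≡⟨ dot-cong c (λ k → solve 3 (λ e x y → x :+ e :* (x :- y) := (con 1ℚ :+ e) :* x :+ (:- e) :* y) refl ε (x k) (y k)) ⟩
  dot c (λ k → (1ℚ + ε) * x k + (- ε) * y k)    ≡⟨ dot-affine c x y (1ℚ + ε) (- ε) ⟩
  (1ℚ + ε) * dot c x + (- ε) * dot c y          ≡⟨ solve 3 (λ e X Y → (con 1ℚ :+ e) :* X :+ (:- e) :* Y := X :+ e :* (X :- Y)) refl ε (dot c x) (dot c y) ⟩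
  dot c x + ε * (dot c x - dot c y)             ∎
  where open ≡-Reasoning

dot≡0-behind : (c x y : Point d) {ε : ℚ} → 0ℚ < ε →
  dot c x ≡ 0ℚ → dot c (λ k → x k + ε * (x k - y k)) ≡ 0ℚ → dot c y ≡ 0ℚ
dot≡0-behind c x y {ε} ε>0 cx≡0 cz≡0 = neg-injective (*-cancelˡ-≡0 ε>0 (begin
  ε * - dot c y                        ≡⟨ solve 2 (λ e Y → e :* (:- Y) := con 0ℚ :+ e :* (con 0ℚ :- Y)) refl ε (dot c y) ⟩
  0ℚ + ε * (0ℚ - dot c y)              ≡⟨ cong (λ X → X + ε * (X - dot c y)) cx≡0 ⟨
  dot c x + ε * (dot c x - dot c y)    ≡⟨ dot-extension c x y ε ⟨
  dot c (λ k → x k + ε * (x k - y k))  ≡⟨ cz≡0 ⟩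
  0ℚ                                   ∎))
  where open ≡-Reasoning

-- Edge polytopes

Σ² : (Fin d → Fin d → ℚ) → ℚ
Σ² {d} F = Σ[ d ] (λ i → Σ[ d ] (λ j → F i j))

Σ²-cong : {F G : Fin d → Fin d → ℚ} → (∀ i j → F i j ≡ G i j) → Σ² F ≡ Σ² G
Σ²-cong {d} F≗G = Σ-cong d (λ i → Σ-cong d (F≗G i))

Σ²-*ˡ : ∀ c (F : Fin d → Fin d → ℚ) → Σ² (λ i j → c * F i j) ≡ c * Σ² F
Σ²-*ˡ {d} c F = trans (Σ-cong d (λ i → Σ-*ˡ d c (F i))) (Σ-*ˡ d c _)

Σ²-*ʳ : ∀ c (F : Fin d → Fin d → ℚ) → Σ² (λ i j → F i j * c) ≡ Σ² F * c
Σ²-*ʳ {d} c F = trans (Σ-cong d (λ i → Σ-*ʳ d c (F i))) (Σ-*ʳ d c _)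

Σ²-mono : {F G : Fin d → Fin d → ℚ} → (∀ i j → F i j ≤ G i j) → Σ² F ≤ Σ² G
Σ²-mono {d} F≤G = Σ-mono d (λ i → Σ-mono d (F≤G i))

Σ²-nonneg : {F : Fin d → Fin d → ℚ} → (∀ i j → 0ℚ ≤ F i j) → 0ℚ ≤ Σ² F
Σ²-nonneg {d} F≥0 = Σ-nonneg d (λ i → Σ-nonneg d (F≥0 i))

term≤Σ² : {F : Fin d → Fin d → ℚ} → (∀ i j → 0ℚ ≤ F i j) → ∀ i j → F i j ≤ Σ² F
term≤Σ² {d} F≥0 i j =
  ≤-trans (term≤Σ d (F≥0 i) j) (term≤Σ d (λ i → Σ-nonneg d (F≥0 i)) i)

Σ²-δδ : (u w : Fin d) (F : Fin d → Fin d → ℚ) → Σ² (λ i j → (δ u i * δ w j) * F i j) ≡ F u w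
Σ²-δδ {d} u w F = begin
  Σ[ d ] (λ i → Σ[ d ] (λ j → (δ u i * δ w j) * F i j))  ≡⟨ Σ-cong d (λ i → trans (Σ-cong d (λ j → *-assoc (δ u i) (δ w j) (F i j))) (Σ-*ˡ d (δ u i) _)) ⟩
  Σ[ d ] (λ i → δ u i * Σ[ d ] (λ j → δ w j * F i j))    ≡⟨ Σ-cong d (λ i → cong (δ u i *_) (Σ-δ d w (F i))) ⟩
  Σ[ d ] (λ i → δ u i * F i w)                           ≡⟨ Σ-δ d u (λ i → F i w) ⟩
  F u w                                                  ∎
  where open ≡-Reasoning

Σ²-Σ : ∀ m (F : Fin m → Fin d → Fin d → ℚ) → Σ² (λ i j → Σ[ m ] (λ t → F t i j)) ≡ Σ[ m ] (λ t → Σ² (F t))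
Σ²-Σ {d} m F = trans (Σ-cong d (λ i → Σ-comm d m (λ j t → F t i j))) (Σ-comm d m (λ i t → Σ[ d ] (F t i)))

edgeComb : (Fin d → Fin d → ℚ) → Point d
edgeComb μ k = Σ² (λ i j → μ i j * ρ i j k)

dot-edgeComb : (c : Point d) (μ : Fin d → Fin d → ℚ) → dot c (edgeComb μ) ≡ Σ² (λ i j → μ i j * (c i + c j))
dot-edgeComb {d} c μ = begin
  Σ[ d ] (λ k → c k * Σ² (λ i j → μ i j * ρ i j k))          ≡⟨ Σ-cong d (λ k → Σ²-*ˡ {d} (c k) _) ⟨
  Σ[ d ] (λ k → Σ² (λ i j → c k * (μ i j * ρ i j k)))        ≡⟨ Σ-comm d d _ ⟩
  Σ[ d ] (λ i → Σ[ d ] (λ k → Σ[ d ] (λ j → c k * (μ i j * ρ i j k)))) ≡⟨ Σ-cong d (λ i → Σ-comm d d _) ⟩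
  Σ² (λ i j → Σ[ d ] (λ k → c k * (μ i j * ρ i j k)))        ≡⟨ Σ²-cong (λ i j → Σ-cong d (λ k → solve 3 (λ c m r → c :* (m :* r) := m :* (c :* r)) refl (c k) (μ i j) (ρ i j k))) ⟩
  Σ² (λ i j → Σ[ d ] (λ k → μ i j * (c k * ρ i j k)))        ≡⟨ Σ²-cong (λ i j → Σ-*ˡ d (μ i j) _) ⟩
  Σ² (λ i j → μ i j * dot c (ρ i j))                         ≡⟨ Σ²-cong (λ i j → cong (μ i j *_) (dot-ρ c i j)) ⟩
  Σ² (λ i j → μ i j * (c i + c j))                           ∎
  where open ≡-Reasoning

dot-EdgePolytope : {K : Graph d} {x : Point d} (c : Point d) (x∈P : EdgePolytope K x) →
  dot c x ≡ Σ² (λ i j → proj₁ x∈P i j * (c i + c j))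
dot-EdgePolytope c (μ , _ , _ , _ , x≡) = trans (dot-cong c x≡) (dot-edgeComb c μ)

EdgePolytope-dot-≥ : {K : Graph d} {x : Point d} (c : Point d) {r : ℚ} →
  (∀ i j → adj K i j ≡ true → r ≤ c i + c j) → EdgePolytope K x → r ≤ dot c x
EdgePolytope-dot-≥ {K = K} {x} c {r} r≤c x∈P@(μ , μ≥0 , μ-off , Σμ≡1 , _) = begin
  r                                  ≡⟨ *-identityˡ r ⟨
  1ℚ * r                             ≡⟨ cong (_* r) Σμ≡1 ⟨
  Σ² μ * r                           ≡⟨ Σ²-*ʳ r μ ⟨
  Σ² (λ i j → μ i j * r)             ≤⟨ Σ²-mono termwise ⟩
  Σ² (λ i j → μ i j * (c i + c j))   ≡⟨ dot-EdgePolytope {K = K} c x∈P ⟨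
  dot c x                            ∎
  where
  open ≤-Reasoning
  termwise : ∀ i j → μ i j * r ≤ μ i j * (c i + c j)
  termwise i j with adj K i j in e
  ... | true  = *-monoˡ-≤-nonNeg (μ i j) {{nonNegative (μ≥0 i j)}} (r≤c i j e)
  ... | false = ≤-reflexive (trans (cong (_* r) (μ-off i j e)) (trans (*-zeroˡ r) (sym (trans (cong (_* (c i + c j)) (μ-off i j e)) (*-zeroˡ (c i + c j))))))

EdgePolytope-dot-≡ : {K : Graph d} {x : Point d} (c : Point d) {r : ℚ} →
  (∀ i j → adj K i j ≡ true → c i + c j ≡ r) → EdgePolytope K x → dot c x ≡ r
EdgePolytope-dot-≡ {K = K} {x} c {r} c≡r x∈P@(μ , _ , μ-off , Σμ≡1 , _) = begin
  dot c x                            ≡⟨ dot-EdgePolytope {K = K} c x∈P ⟩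
  Σ² (λ i j → μ i j * (c i + c j))   ≡⟨ Σ²-cong termwise ⟩
  Σ² (λ i j → μ i j * r)             ≡⟨ Σ²-*ʳ r μ ⟩
  Σ² μ * r                           ≡⟨ cong (_* r) Σμ≡1 ⟩
  1ℚ * r                             ≡⟨ *-identityˡ r ⟩
  r                                  ∎
  where
  open ≡-Reasoning
  termwise : ∀ i j → μ i j * (c i + c j) ≡ μ i j * r
  termwise i j with adj K i j in e
  ... | true  = cong (μ i j *_) (c≡r i j e)
  ... | false = trans (cong (_* (c i + c j)) (μ-off i j e)) (trans (*-zeroˡ (c i + c j)) (sym (trans (cong (_* r) (μ-off i j e)) (*-zeroˡ r))))

Σ≡dot1 : (x : Point d) → Σ[ d ] x ≡ dot (λ _ → 1ℚ) x
Σ≡dot1 {d} x = Σ-cong d (λ k → sym (*-identityˡ (x k)))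

EdgePolytope-Σ≡2 : {K : Graph d} {x : Point d} → EdgePolytope K x → Σ[ d ] x ≡ 1ℚ + 1ℚ
EdgePolytope-Σ≡2 {K = K} {x} x∈P = trans (Σ≡dot1 x) (EdgePolytope-dot-≡ {K = K} (λ _ → 1ℚ) (λ _ _ _ → refl) x∈P)

EdgePolytope-nonneg : {K : Graph d} {x : Point d} → EdgePolytope K x → ∀ k → 0ℚ ≤ x k
EdgePolytope-nonneg (μ , μ≥0 , _ , _ , x≡) k =
  subst (0ℚ ≤_) (sym (x≡ k)) (Σ²-nonneg (λ i j → nonNeg*nonNeg (μ≥0 i j) (ρ-nonneg i j k)))

weight≤coord : {K : Graph d} {x : Point d} (x∈P : EdgePolytope K x) {i j k : Fin d} →
  k ≡ i ⊎ k ≡ j → proj₁ x∈P i j ≤ x k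
weight≤coord {x = x} (μ , μ≥0 , _ , _ , x≡) {i} {j} {k} k∈ij = begin
  μ i j                 ≡⟨ *-identityʳ (μ i j) ⟨
  μ i j * 1ℚ            ≤⟨ *-monoˡ-≤-nonNeg (μ i j) {{nonNegative (μ≥0 i j)}} (ρ-endpoint≥1 i j k k∈ij) ⟩
  μ i j * ρ i j k       ≤⟨ term≤Σ² (λ i′ j′ → nonNeg*nonNeg (μ≥0 i′ j′) (ρ-nonneg i′ j′ k)) i j ⟩
  edgeComb μ k          ≡⟨ x≡ k ⟨
  x k                   ∎
  where open ≤-Reasoning

weight≢0⇒edge : {K : Graph d} {x : Point d} (x∈P : EdgePolytope K x) {i j : Fin d} →
  ¬ proj₁ x∈P i j ≡ 0ℚ → adj K i j ≡ true
weight≢0⇒edge {K = K} (_ , _ , μ-off , _) {i} {j} μ≢0 with adj K i j in e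
... | true  = refl
... | false = ⊥-elim (μ≢0 (μ-off i j e))

EdgePolytope-restrict : {K K′ : Graph d} {x : Point d} (x∈P : EdgePolytope K x) →
  (∀ i j → ¬ proj₁ x∈P i j ≡ 0ℚ → adj K′ i j ≡ true) → EdgePolytope K′ x
EdgePolytope-restrict {K′ = K′} (μ , μ≥0 , _ , Σμ≡1 , x≡) support = μ , μ≥0 , μ-off′ , Σμ≡1 , x≡
  where
  μ-off′ : ∀ i j → adj K′ i j ≡ false → μ i j ≡ 0ℚ
  μ-off′ i j e with μ i j ≟ 0ℚ
  ... | yes μ≡0 = μ≡0
  ... | no  μ≢0 = contradiction (trans (sym (support i j μ≢0)) e) λ ()

EdgePolytope-mono : {K K′ : Graph d} {x : Point d} → SpanningSubgraph K K′ → EdgePolytope K x → EdgePolytope K′ x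
EdgePolytope-mono {K = K} {K′} K⊆K′ x∈P =
  EdgePolytope-restrict {K = K} {K′} x∈P (λ i j μ≢0 → K⊆K′ i j (weight≢0⇒edge {K = K} x∈P μ≢0))

vertex∈EdgePolytope : (K : Graph d) {u w : Fin d} → adj K u w ≡ true → EdgePolytope K (ρ u w)
vertex∈EdgePolytope {d} K {u} {w} uw∈K = μ , μ≥0 , μ-off , Σμ≡1 , ρ≡
  where
  μ : Fin d → Fin d → ℚ
  μ i j = δ u i * δ w j
  μ≥0 : ∀ i j → 0ℚ ≤ μ i j
  μ≥0 i j = nonNeg*nonNeg (δ-nonneg u i) (δ-nonneg w j)
  μ-off : ∀ i j → adj K i j ≡ false → μ i j ≡ 0ℚ
  μ-off i j ij∉K with u ≟ᶠ i | w ≟ᶠ j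
  ... | yes refl | yes refl = contradiction (trans (sym uw∈K) ij∉K) λ ()
  ... | no  u≢i  | _        = trans (cong (_* δ w j) (δ-off u i u≢i)) (*-zeroˡ (δ w j))
  ... | yes _    | no  w≢j  = trans (cong (δ u i *_) (δ-off w j w≢j)) (*-zeroʳ (δ u i))
  Σμ≡1 : Σ² μ ≡ 1ℚ
  Σμ≡1 = trans (Σ²-cong (λ i j → sym (*-identityʳ (μ i j)))) (Σ²-δδ u w (λ _ _ → 1ℚ))
  ρ≡ : ∀ k → ρ u w k ≡ edgeComb μ k
  ρ≡ k = sym (Σ²-δδ u w (λ i j → ρ i j k))

Conv-vertex : (v : Fin m → Point d) (t : Fin m) → Conv v (v t)
Conv-vertex {m} v t =
  δ t , δ-nonneg t , trans (Σ-cong m (λ s → sym (*-identityʳ (δ t s)))) (Σ-δ m t (λ _ → 1ℚ)) ,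
  λ k → sym (Σ-δ m t (λ s → v s k))

Conv⊆EdgePolytope : {K : Graph d} (v : Fin m → Point d) → (∀ t → EdgePolytope K (v t)) →
  ∀ {x} → Conv v x → EdgePolytope K x
Conv⊆EdgePolytope {d} {m} {K} v v∈P {x} (θ , θ≥0 , Σθ≡1 , x≡) = Λ , Λ≥0 , Λ-off , ΣΛ≡1 , x≡edgeComb
  where
  μ : Fin m → Fin d → Fin d → ℚ
  μ t = proj₁ (v∈P t)
  Λ : Fin d → Fin d → ℚ
  Λ i j = Σ[ m ] (λ t → θ t * μ t i j)
  Λ≥0 : ∀ i j → 0ℚ ≤ Λ i j
  Λ≥0 i j = Σ-nonneg m (λ t → nonNeg*nonNeg (θ≥0 t) (proj₁ (proj₂ (v∈P t)) i j))
  Λ-off : ∀ i j → adj K i j ≡ false → Λ i j ≡ 0ℚ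
  Λ-off i j ij∉K =
    trans (Σ-cong m (λ t → trans (cong (θ t *_) (proj₁ (proj₂ (proj₂ (v∈P t))) i j ij∉K)) (*-zeroʳ (θ t)))) (Σ-zero m)
  ΣΛ≡1 : Σ² Λ ≡ 1ℚ
  ΣΛ≡1 = begin
    Σ² Λ                                   ≡⟨ Σ²-Σ m (λ t i j → θ t * μ t i j) ⟩
    Σ[ m ] (λ t → Σ² (λ i j → θ t * μ t i j)) ≡⟨ Σ-cong m (λ t → Σ²-*ˡ (θ t) (μ t)) ⟩
    Σ[ m ] (λ t → θ t * Σ² (μ t))          ≡⟨ Σ-cong m (λ t → trans (cong (θ t *_) (proj₁ (proj₂ (proj₂ (proj₂ (v∈P t)))))) (*-identityʳ (θ t))) ⟩
    Σ[ m ] θ                               ≡⟨ Σθ≡1 ⟩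
    1ℚ                                     ∎
    where open ≡-Reasoning
  x≡edgeComb : ∀ k → x k ≡ edgeComb Λ k
  x≡edgeComb k = begin
    x k                                                       ≡⟨ x≡ k ⟩
    Σ[ m ] (λ t → θ t * v t k)                                ≡⟨ Σ-cong m (λ t → cong (θ t *_) (proj₂ (proj₂ (proj₂ (proj₂ (v∈P t)))) k)) ⟩
    Σ[ m ] (λ t → θ t * edgeComb (μ t) k)                     ≡⟨ Σ-cong m (λ t → Σ²-*ˡ {d} (θ t) _) ⟨
    Σ[ m ] (λ t → Σ² (λ i j → θ t * (μ t i j * ρ i j k)))     ≡⟨ Σ²-Σ {d} m _ ⟨
    Σ² (λ i j → Σ[ m ] (λ t → θ t * (μ t i j * ρ i j k)))     ≡⟨ Σ²-cong (λ i j → trans (Σ-cong m (λ t → sym (*-assoc (θ t) (μ t i j) (ρ i j k)))) (Σ-*ʳ m (ρ i j k) _)) ⟩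
    edgeComb Λ k                                              ∎
    where open ≡-Reasoning

EdgePolytope-convex : {K : Graph d} {x y : Point d} {p q : ℚ} → EdgePolytope K x → EdgePolytope K y →
  0ℚ ≤ p → 0ℚ ≤ q → p + q ≡ 1ℚ → EdgePolytope K (λ k → p * x k + q * y k)
EdgePolytope-convex {d} {K} {x} {y} {p} {q} x∈P y∈P p≥0 q≥0 p+q≡1 =
  Conv⊆EdgePolytope {K = K} v (λ { zero → x∈P ; (suc _) → y∈P })
    ( (λ { zero → p ; (suc _) → q }) , (λ { zero → p≥0 ; (suc _) → q≥0 })
    , trans (cong (p +_) (+-identityʳ q)) p+q≡1
    , λ k → cong (p * x k +_) (sym (+-identityʳ (q * y k))) )
  where
  v : Fin 2 → Point d
  v zero    = x
  v (suc _) = y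

IntegralPolytope-resp : {P Q : Region d} → P ≐ Q → IntegralPolytope P → IntegralPolytope Q
IntegralPolytope-resp P≐Q (m , v , P≐Conv) = m , v , λ x → ⇔.trans (⇔.sym (P≐Q x)) (P≐Conv x)

integral-point-vertex : {K : Graph d} {x : Point d} → (∀ k → ∃[ z ] (x k ≡ z / 1)) →
  (x∈P : EdgePolytope K x) {i j : Fin d} → ¬ proj₁ x∈P i j ≡ 0ℚ → ∀ k → x k ≡ ρ i j k
integral-point-vertex {d} {K} {x} integral x∈P {i} {j} μ≢0 k = sym (Σ-≤-≡ d ρ≤x Σρ≡Σx k)
  where
  i≢j : ¬ i ≡ j
  i≢j refl = contradiction (trans (sym (weight≢0⇒edge {K = K} x∈P μ≢0)) (irrefl K i)) λ ()
  endpoint≥1 : ∀ {k} → k ≡ i ⊎ k ≡ j → 1ℚ ≤ x k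
  endpoint≥1 {k} k∈ij with integral k
  ... | z , xk≡z = subst (1ℚ ≤_) (sym xk≡z) (positive-integer⇒≥1 z (subst (0ℚ <_) xk≡z xk>0))
    where
    xk>0 : 0ℚ < x k
    xk>0 = <-≤-trans (nonneg∧≢0⇒pos (proj₁ (proj₂ x∈P) i j) μ≢0) (weight≤coord {K = K} x∈P k∈ij)
  ρ≤x : ∀ k → ρ i j k ≤ x k
  ρ≤x k with k ≟ᶠ i | k ≟ᶠ j
  ... | yes k≡i | _       = ≤-trans (≤-reflexive (ρ-endpoint i j k i≢j (inj₁ k≡i))) (endpoint≥1 (inj₁ k≡i))
  ... | no  _   | yes k≡j = ≤-trans (≤-reflexive (ρ-endpoint i j k i≢j (inj₂ k≡j))) (endpoint≥1 (inj₂ k≡j))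
  ... | no  k≢i | no  k≢j = ≤-trans (≤-reflexive (ρ-outside i j k k≢i k≢j)) (EdgePolytope-nonneg {K = K} x∈P k)
  Σρ≡Σx : Σ[ d ] (ρ i j) ≡ Σ[ d ] x
  Σρ≡Σx = trans (Σ≡dot1 (ρ i j)) (trans (dot-ρ (λ _ → 1ℚ) i j) (sym (EdgePolytope-Σ≡2 {K = K} x∈P)))

support-neighbour : {K : Graph d} {y : Point d} → EdgePolytope K y →
  ∀ {w} → 0ℚ < y w → ∃[ j ] (adj K w j ≡ true × 0ℚ < y j)
support-neighbour {d} {K} {y} y∈P@(μ , μ≥0 , _ , _ , y≡) {w} yw>0 with Σ-pos d (subst (0ℚ <_) (y≡ w) yw>0)
... | i , row>0 with Σ-pos d row>0
... | j , term>0 = neighbour (ρ-support i j w ρ>0)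
  where
  μ≢0 : ¬ μ i j ≡ 0ℚ
  μ≢0 μ≡0 = <-irrefl (sym (trans (cong (_* ρ i j w) μ≡0) (*-zeroˡ (ρ i j w)))) term>0
  ρ>0 : 0ℚ < ρ i j w
  ρ>0 = nonneg∧≢0⇒pos (ρ-nonneg i j w) λ ρ≡0 → <-irrefl (sym (trans (cong (μ i j *_) ρ≡0) (*-zeroʳ (μ i j)))) term>0
  μ>0 : 0ℚ < μ i j
  μ>0 = nonneg∧≢0⇒pos (μ≥0 i j) μ≢0
  ij∈K : adj K i j ≡ true
  ij∈K = weight≢0⇒edge {K = K} y∈P μ≢0
  neighbour : w ≡ i ⊎ w ≡ j → ∃[ j ] (adj K w j ≡ true × 0ℚ < y j)
  neighbour (inj₁ refl) = j , ij∈K , <-≤-trans μ>0 (weight≤coord {K = K} y∈P (inj₂ refl))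
  neighbour (inj₂ refl) = i , trans (adj-sym K j i) ij∈K , <-≤-trans μ>0 (weight≤coord {K = K} y∈P (inj₁ refl))

-- Cuts in finite graphs

module _ {d : ℕ} (K : Graph d) where

  Closed : Subset d → Set
  Closed S = ∀ {i j} → adj K i j ≡ true → j ∈ S → i ∈ S

  closed-or-escape : (S : Subset d) → Closed S ⊎ ∃₂ λ i j → adj K i j ≡ true × j ∈ S × i ∉ S
  closed-or-escape S with any? (λ i → any? (λ j → (adj K i j Bool.≟ true) ×-dec (j ∈? S) ×-dec ¬? (i ∈? S)))
  ... | yes (i , j , escape) = inj₂ (i , j , escape)
  ... | no  none             = inj₁ λ {i} {j} ij∈K j∈S →
    decidable-stable (i ∈? S) (λ i∉S → none (i , j , ij∈K , j∈S , i∉S))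

  Closed-∁ : {S : Subset d} → Closed S → Closed (∁ S)
  Closed-∁ closed {i} {j} ij∈K j∈∁S =
    x∉p⇒x∈∁p (λ i∈S → x∈∁p⇒x∉p j∈∁S (closed (trans (adj-sym K j i) ij∈K) i∈S))

  -- Grow S from ⁅ w ⁆ by predecessors until it is closed; S only grows, so d rounds suffice.
  reach-or-cut : (u w : Fin d) → Reach K u w ⊎ ∃[ S ] (Closed S × w ∈ S × u ∉ S)
  reach-or-cut u w = grow d ⁅ w ⁆ (x∈⁅x⁆ w) reaches-w (ℕ.m≤m+n d ∣ ⁅ w ⁆ ∣)
    where
    reaches-w : ∀ {v} → v ∈ ⁅ w ⁆ → Reach K v w
    reaches-w v∈⁅w⁆ rewrite x∈⁅y⁆⇒x≡y w v∈⁅w⁆ = here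
    grow : (n : ℕ) (S : Subset d) → w ∈ S → (∀ {v} → v ∈ S → Reach K v w) → d ℕ.≤ n ℕ.+ ∣ S ∣ →
      Reach K u w ⊎ ∃[ S ] (Closed S × w ∈ S × u ∉ S)
    grow n S w∈S reach d≤n+∣S∣ with u ∈? S | closed-or-escape S
    ... | yes u∈S | _                             = inj₁ (reach u∈S)
    ... | no  u∉S | inj₁ closed                   = inj₂ (S , closed , w∈S , u∉S)
    ... | no  _   | inj₂ (i , j , ij∈K , j∈S , i∉S) = grow-by-i n d≤n+∣S∣
      where
      S⊂S∪i : S ⊂ S ∪ ⁅ i ⁆
      S⊂S∪i = p⊆p∪q ⁅ i ⁆ , i , q⊆p∪q S ⁅ i ⁆ (x∈⁅x⁆ i) , i∉S
      reach′ : ∀ {v} → v ∈ S ∪ ⁅ i ⁆ → Reach K v w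
      reach′ {v} v∈S∪i with x∈p∪q⁻ S ⁅ i ⁆ v∈S∪i
      ... | inj₁ v∈S   = reach v∈S
      ... | inj₂ v∈⁅i⁆ rewrite x∈⁅y⁆⇒x≡y i v∈⁅i⁆ = step ij∈K (reach j∈S)
      grow-by-i : (n : ℕ) → d ℕ.≤ n ℕ.+ ∣ S ∣ → Reach K u w ⊎ ∃[ S ] (Closed S × w ∈ S × u ∉ S)
      grow-by-i zero    d≤∣S∣ = ⊥-elim (ℕ.<-irrefl refl (ℕ.<-≤-trans (ℕ.≤-<-trans d≤∣S∣ (p⊂q⇒∣p∣<∣q∣ S⊂S∪i)) (∣p∣≤n (S ∪ ⁅ i ⁆))))
      grow-by-i (suc n) d≤n+1+∣S∣ =
        grow n (S ∪ ⁅ i ⁆) (p⊆p∪q ⁅ i ⁆ w∈S) reach′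
          (ℕ.≤-trans d≤n+1+∣S∣ (ℕ.≤-trans (ℕ.≤-reflexive (sym (ℕ.+-suc n ∣ S ∣))) (ℕ.+-monoʳ-≤ n (p⊂q⇒∣p∣<∣q∣ S⊂S∪i))))

  crossing-edge : (S : Subset d) {u w : Fin d} → Reach K u w → u ∉ S → w ∈ S →
    ∃₂ λ i j → adj K i j ≡ true × i ∉ S × j ∈ S
  crossing-edge S here                   u∉S u∈S = contradiction u∈S u∉S
  crossing-edge S (step {j = v} uv∈K path) u∉S w∈S with v ∈? S
  ... | yes v∈S = _ , v , uv∈K , u∉S , v∈S
  ... | no  v∉S = crossing-edge S path v∉S w∈S

module HalfSpaceSlice {d : ℕ} (G : Graph d) (a : Point d) (b : ℚ) where

  Above : Region d
  Above x = b ≤ dot a x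

  Slice : Region d
  Slice = EdgePolytope G ∩ Above

  G₊ : Graph d
  G₊ = record
    { adj    = λ i j → adj G i j ∧ does (b ≤? a i + a j)
    ; sym    = λ i j → cong₂ _∧_ (adj-sym G i j) (cong (λ s → does (b ≤? s)) (+-comm (a i) (a j)))
    ; irrefl = λ i → cong (_∧ does (b ≤? a i + a i)) (irrefl G i)
    }

  G₊-edge : ∀ {i j} → adj G₊ i j ≡ true → adj G i j ≡ true × b ≤ a i + a j
  G₊-edge {i} {j} = split (adj G i j) (b ≤? a i + a j)
    where
    split : ∀ x (b≤? : Dec (b ≤ a i + a j)) → x ∧ does b≤? ≡ true → x ≡ true × b ≤ a i + a j
    split true  (yes b≤aᵢ+aⱼ) _ = refl , b≤aᵢ+aⱼ
    split true  (no  _)      ()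
    split false _            ()

  G₊-intro : ∀ {i j} → adj G i j ≡ true → b ≤ a i + a j → adj G₊ i j ≡ true
  G₊-intro {i} {j} ij∈G b≤aᵢ+aⱼ = join ij∈G (b ≤? a i + a j)
    where
    join : ∀ {x} → x ≡ true → (b≤? : Dec (b ≤ a i + a j)) → x ∧ does b≤? ≡ true
    join refl (yes _)      = refl
    join refl (no  b≰aᵢ+aⱼ) = contradiction b≤aᵢ+aⱼ b≰aᵢ+aⱼ

  G₊⊆G : SpanningSubgraph G₊ G
  G₊⊆G i j ij∈G₊ = proj₁ (G₊-edge ij∈G₊)

  EdgePolytope₊⊆Slice : ∀ {x} → EdgePolytope G₊ x → Slice x
  EdgePolytope₊⊆Slice x∈P₊ =
    EdgePolytope-mono {K = G₊} {G} G₊⊆G x∈P₊ , EdgePolytope-dot-≥ {K = G₊} a (λ i j ij∈G₊ → proj₂ (G₊-edge ij∈G₊)) x∈P₊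

  -- A vertex of the integral polytope Slice is a lattice point of P_G, hence some ρ(i,j); every edge
  -- carrying weight in it is that edge, which lies above the hyperplane, so the vertex is in P_{G₊}.
  Slice⊆EdgePolytope₊ : IntegralPolytope Slice → ∀ {x} → Slice x → EdgePolytope G₊ x
  Slice⊆EdgePolytope₊ (m , v , Slice≐Conv) x∈Slice =
    Conv⊆EdgePolytope {K = G₊} vertex vertex∈P₊ (Equivalence.to (Slice≐Conv _) x∈Slice)
    where
    vertex : Fin m → Point d
    vertex t k = v t k / 1
    vertex∈P₊ : ∀ t → EdgePolytope G₊ (vertex t)
    vertex∈P₊ t = EdgePolytope-restrict {K = G} {G₊} vt∈P support
      where
      vt∈Slice : Slice (vertex t)
      vt∈Slice = Equivalence.from (Slice≐Conv (vertex t)) (Conv-vertex vertex t)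
      vt∈P : EdgePolytope G (vertex t)
      vt∈P = proj₁ vt∈Slice
      support : ∀ i j → ¬ proj₁ vt∈P i j ≡ 0ℚ → adj G₊ i j ≡ true
      support i j μ≢0 = G₊-intro (weight≢0⇒edge {K = G} vt∈P μ≢0) (begin
        b                   ≤⟨ proj₂ vt∈Slice ⟩
        dot a (vertex t)    ≡⟨ dot-cong a (integral-point-vertex {K = G} (λ k → v t k , refl) vt∈P μ≢0) ⟩
        dot a (ρ i j)       ≡⟨ dot-ρ a i j ⟩
        a i + a j           ∎)
        where open ≤-Reasoning

  Balanced : Point d → Set
  Balanced c = ∀ {i j} → adj G₊ i j ≡ true → c i + c j ≡ 0ℚ

  module _ (Slice⊆P₊ : ∀ {x} → Slice x → EdgePolytope G₊ x)
           {x₀ : Point d} (x₀∈ri : RelInt (EdgePolytope G) x₀) (x₀∈H : dot a x₀ ≡ b) where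

    -- As x₀ is relatively interior, the segment from ρ(u,w) (below H) through x₀ ∈ H extends
    -- beyond x₀ inside P_G, i.e. into the slice, where c vanishes; by linearity c vanishes at ρ(u,w).
    balanced-extends : (c : Point d) → Balanced c →
      ∀ {u w} → adj G u w ≡ true → a u + a w ≤ b → c u + c w ≡ 0ℚ
    balanced-extends c balanced {u} {w} uw∈G uw-below with proj₂ x₀∈ri (ρ u w) (vertex∈EdgePolytope G uw∈G)
    ... | ε , ε>0 , z∈P =
      trans (sym (dot-ρ c u w)) (dot≡0-behind c x₀ (ρ u w) ε>0 (vanishes x₀∈Slice) (vanishes (z∈P , z-above)))
      where
      vanishes : ∀ {y} → Slice y → dot c y ≡ 0ℚ
      vanishes y∈Slice = EdgePolytope-dot-≡ {K = G₊} c (λ _ _ → balanced) (Slice⊆P₊ y∈Slice)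
      x₀∈Slice : Slice x₀
      x₀∈Slice = proj₁ x₀∈ri , ≤-reflexive (sym x₀∈H)
      z-above : b ≤ dot a (λ k → x₀ k + ε * (x₀ k - ρ u w k))
      z-above = begin
        b                                            ≤⟨ p≤p+q (nonNeg*nonNeg (<⇒≤ ε>0) (p≤q⇒0≤q-p uw-below)) ⟩
        b + ε * (b - (a u + a w))                    ≡⟨ cong₂ (λ X Y → X + ε * (X - Y)) x₀∈H (dot-ρ a u w) ⟨
        dot a x₀ + ε * (dot a x₀ - dot a (ρ u w))    ≡⟨ dot-extension a x₀ (ρ u w) ε ⟨
        dot a (λ k → x₀ k + ε * (x₀ k - ρ u w k))    ∎
        where open ≤-Reasoning

    -- If a_p + a_q > b, a point of the segment from ρ(p,q) to ρ(u,w) lies on H, hence in P_{G₊}; its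
    -- positive coordinate at u needs a G₊-edge from u into its support {p,q,u,w} ∖ {u} ⊆ S, so u ∈ S.
    cut-edges-below : (S : Subset d) → Closed G₊ S →
      ∀ {u w} → adj G u w ≡ true → a u + a w < b → u ∉ S → w ∈ S →
      ∀ {p q} → adj G₊ p q ≡ true → q ∈ S → a p + a q ≤ b
    cut-edges-below S closed {u} {w} uw∈G uw-below u∉S w∈S {p} {q} pq∈G₊ q∈S =
      ≮⇒≥ λ pq-above → u∉S (u∈S (convex-weights (<⇒≤ uw-below) pq-above))
      where
      u∈S : (∃₂ λ t s → 0ℚ ≤ t × 0ℚ < s × t + s ≡ 1ℚ × t * (a p + a q) + s * (a u + a w) ≡ b) → u ∈ S
      u∈S (t , s , t≥0 , s>0 , t+s≡1 , on-H) = closed uj∈G₊ j∈S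
        where
        c : Point d
        c k = t * ρ p q k + s * ρ u w k
        c∈Slice : Slice c
        c∈Slice =
            EdgePolytope-convex {K = G} (vertex∈EdgePolytope G (G₊⊆G p q pq∈G₊)) (vertex∈EdgePolytope G uw∈G)
              t≥0 (<⇒≤ s>0) t+s≡1
          , ≤-reflexive (sym (begin
            dot a c                                  ≡⟨ dot-affine a (ρ p q) (ρ u w) t s ⟩
            t * dot a (ρ p q) + s * dot a (ρ u w)    ≡⟨ cong₂ (λ X Y → t * X + s * Y) (dot-ρ a p q) (dot-ρ a u w) ⟩
            t * (a p + a q) + s * (a u + a w)        ≡⟨ on-H ⟩
            b                                        ∎))
          where open ≡-Reasoning
        cu>0 : 0ℚ < c u
        cu>0 = <-≤-trans s>0 (≤-trans s≤sρ (p≤q+p (nonNeg*nonNeg t≥0 (ρ-nonneg p q u))))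
          where
          s≤sρ : s ≤ s * ρ u w u
          s≤sρ = ≤-trans (≤-reflexive (sym (*-identityʳ s)))
                         (*-monoˡ-≤-nonNeg s {{nonNegative (<⇒≤ s>0)}} (ρ-endpoint≥1 u w u (inj₁ refl)))
        neighbour : ∃[ j ] (adj G₊ u j ≡ true × 0ℚ < c j)
        neighbour = support-neighbour {K = G₊} (Slice⊆P₊ c∈Slice) cu>0
        j : Fin d
        j = proj₁ neighbour
        uj∈G₊ : adj G₊ u j ≡ true
        uj∈G₊ = proj₁ (proj₂ neighbour)
        j≢u : ¬ j ≡ u
        j≢u j≡u = contradiction (trans (sym uj∈G₊) (trans (cong (adj G₊ u) j≡u) (irrefl G₊ u))) λ ()
        support⊆S∪u : ∀ {k} → (k ≡ p ⊎ k ≡ q) ⊎ (k ≡ u ⊎ k ≡ w) → k ≡ u ⊎ k ∈ S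
        support⊆S∪u (inj₁ (inj₁ refl)) = inj₂ (closed pq∈G₊ q∈S)
        support⊆S∪u (inj₁ (inj₂ refl)) = inj₂ q∈S
        support⊆S∪u (inj₂ (inj₁ refl)) = inj₁ refl
        support⊆S∪u (inj₂ (inj₂ refl)) = inj₂ w∈S
        j∈S : j ∈ S
        j∈S = [ (λ j≡u → contradiction j≡u j≢u) , id ]′
                (support⊆S∪u (segment-support t s p q u w j (proj₂ (proj₂ neighbour))))

    -- c = 𝟙_S · (2a − b) is balanced: G₊-edges inside S lie on H by cut-edges-below, and none leaves S.
    cut-edge-midpoint : (S : Subset d) → Closed G₊ S →
      ∀ {u w} → adj G u w ≡ true → a u + a w < b → u ∉ S → w ∈ S → a w + a w ≡ b
    cut-edge-midpoint S closed {u} {w} uw∈G uw-below u∉S w∈S =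
      p-q≡0⇒p≡q (a w + a w) b (begin
        a w + a w - b     ≡⟨ c-inside w∈S ⟨
        c w               ≡⟨ +-identityˡ (c w) ⟨
        0ℚ + c w          ≡⟨ cong (_+ c w) (c-outside u∉S) ⟨
        c u + c w         ≡⟨ balanced-extends c balanced uw∈G (<⇒≤ uw-below) ⟩
        0ℚ                ∎)
      where
      open ≡-Reasoning
      c : Point d
      c k = if does (k ∈? S) then a k + a k - b else 0ℚ
      c-inside : ∀ {k} → k ∈ S → c k ≡ a k + a k - b
      c-inside {k} k∈S rewrite dec-true (k ∈? S) k∈S = refl
      c-outside : ∀ {k} → k ∉ S → c k ≡ 0ℚ
      c-outside {k} k∉S rewrite dec-false (k ∈? S) k∉S = refl
      balanced : Balanced c
      balanced {i} {j} ij∈G₊ = by-side (j ∈? S)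
        where
        by-side : Dec (j ∈ S) → c i + c j ≡ 0ℚ
        by-side (yes j∈S) = begin
          c i + c j                               ≡⟨ cong₂ _+_ (c-inside (closed ij∈G₊ j∈S)) (c-inside j∈S) ⟩
          (a i + a i - b) + (a j + a j - b)       ≡⟨ solve 3 (λ x y b → (x :+ x :- b) :+ (y :+ y :- b) := (x :+ y :- b) :+ (x :+ y :- b)) refl (a i) (a j) b ⟩
          (a i + a j - b) + (a i + a j - b)       ≡⟨ cong (λ X → (X - b) + (X - b)) on-H ⟩
          (b - b) + (b - b)                       ≡⟨ cong₂ _+_ (+-inverseʳ b) (+-inverseʳ b) ⟩
          0ℚ                                      ∎
          where
          on-H : a i + a j ≡ b
          on-H = ≤-antisym (cut-edges-below S closed uw∈G uw-below u∉S w∈S ij∈G₊ j∈S) (proj₂ (G₊-edge ij∈G₊))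
        by-side (no j∉S) = trans (cong₂ _+_ (c-outside i∉S) (c-outside j∉S)) (+-identityˡ 0ℚ)
          where
          i∉S : i ∉ S
          i∉S i∈S = j∉S (closed (trans (adj-sym G₊ j i) ij∈G₊) i∈S)

    G₊-connected : Connected G → Connected G₊
    G₊-connected G-connected i j with reach-or-cut G₊ i j
    ... | inj₁ path = path
    ... | inj₂ (S , closed , j∈S , i∉S) with crossing-edge G S (G-connected i j) i∉S j∈S
    ...   | u , w , uw∈G , u∉S , w∈S = ⊥-elim (<-irrefl doubled (+-mono-< uw-below uw-below))
      where
      uw-below : a u + a w < b
      uw-below = ≰⇒> λ uw-above → u∉S (closed (G₊-intro uw∈G uw-above) w∈S)
      wu∈G : adj G w u ≡ true
      wu∈G = trans (adj-sym G w u) uw∈G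
      wu-below : a w + a u < b
      wu-below = subst (_< b) (+-comm (a u) (a w)) uw-below
      doubled : (a u + a w) + (a u + a w) ≡ b + b
      doubled = begin
        (a u + a w) + (a u + a w)   ≡⟨ solve 2 (λ x y → (x :+ y) :+ (x :+ y) := (x :+ x) :+ (y :+ y)) refl (a u) (a w) ⟩
        (a u + a u) + (a w + a w)   ≡⟨ cong₂ _+_ (cut-edge-midpoint (∁ S) (Closed-∁ G₊ closed) wu∈G wu-below
                                                                (x∈p⇒x∉∁p w∈S) (x∉p⇒x∈∁p u∉S))
                                                (cut-edge-midpoint S closed uw∈G uw-below u∉S w∈S) ⟩
        b + b                       ∎
        where open ≡-Reasoning

  slice-edgePolytope : Connected G → IntegralPolytope Slice →
    ∀ {x₀} → RelInt (EdgePolytope G) x₀ → dot a x₀ ≡ b →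
    SpanningSubgraph G₊ G × Connected G₊ × (Slice ≐ EdgePolytope G₊)
  slice-edgePolytope G-connected integral x₀∈ri x₀∈H =
    G₊⊆G , G₊-connected (Slice⊆EdgePolytope₊ integral) x₀∈ri x₀∈H G-connected ,
    λ _ → mk⇔ (Slice⊆EdgePolytope₊ integral) EdgePolytope₊⊆Slice

below⇔neg-above : (a x : Point d) (b : ℚ) → dot a x ≤ b ⇔ - b ≤ dot (λ k → - a k) x
below⇔neg-above a x b = mk⇔
  (λ ax≤b → subst (- b ≤_) (sym (dot-neg a x)) (neg-antimono-≤ ax≤b))
  (λ -b≤-ax → subst₂ _≤_ (neg-involutive (dot a x)) (neg-involutive b)
                 (neg-antimono-≤ (subst (- b ≤_) (dot-neg a x) -b≤-ax)))

lemma1p8 : (d : ℕ) (G : Graph d) → Connected G →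
    (H : Hyperplane d) → Separating (EdgePolytope G) H →
    Σ (Graph d) λ G₊ → Σ (Graph d) λ G₋ →
      (SpanningSubgraph G₊ G × Connected G₊ × ((EdgePolytope G ∩ H⁺ H) ≐ EdgePolytope G₊)) ×
      (SpanningSubgraph G₋ G × Connected G₋ × ((EdgePolytope G ∩ H⁻ H) ≐ EdgePolytope G₋))
lemma1p8 d G G-connected H ((x₀ , x₀∈ri , x₀∈H) , _ , integral⁺ , integral⁻) =
  _ , _ , slice-edgePolytope G (a H) (b H) G-connected integral⁺ x₀∈ri x₀∈H ,
  map₂ (map₂ λ Slice≐P₋ x → ⇔.trans (below≐Slice x) (Slice≐P₋ x))
    (slice-edgePolytope G a⁻ b⁻ G-connected (IntegralPolytope-resp below≐Slice integral⁻) x₀∈ri x₀∈H⁻)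
  where
  open HalfSpaceSlice using (Slice; slice-edgePolytope)
  a⁻ : Point d
  a⁻ k = - a H k
  b⁻ : ℚ
  b⁻ = - b H
  below≐Slice : (EdgePolytope G ∩ H⁻ H) ≐ Slice G a⁻ b⁻
  below≐Slice x = mk⇔ (map₂ (Equivalence.to (below⇔neg-above (a H) x (b H))))
                      (map₂ (Equivalence.from (below⇔neg-above (a H) x (b H))))
  x₀∈H⁻ : dot a⁻ x₀ ≡ b⁻
  x₀∈H⁻ = trans (dot-neg (a H) x₀) (cong -_ x₀∈H)
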